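{- Let $\mathcal T$ be a finite set of formulas, each approximable in $\Sigma^{\mathcal I}$ with the $\ll$-relation $\ll$, and let $\mathcal I_0\subseteq\mathcal I$ be finite. Then there is a finite set $\mathcal J$ with $\mathcal I_0\subseteq\mathcal J\subseteq\mathcal I$ which is a possible restriction for $\mathcal T$.
   Context: $\mathcal I$ is a non-empty set with a directed preorder $\le$. Contexts: tuples $C=(i_0,\dots,i_{n-1})\in\mathcal I^n$; $()$ empty, $Ci$ extension by $i$. $\Sigma$ is a first-order signature with relation symbols only; $\Sigma^{\mathcal I}$ is a set of assignments $R:C$ with $C\in\mathcal I^{\mathrm{arity}(R)}$, at least one per symbol. A $\ll$-relation is a family $\ll=(\ll_n)_{n\in\mathbb N}$, $\ll_n\subseteq\mathcal I^n$, with $Ci\in\ll_{n+1}\Rightarrow C\in\ll_n$; its elements are $\ll$-contexts; $C\ll i$ means $Ci\in\ll_{n+1}$. Formulas: first-order over $\Sigma$ with variables $x_0,x_1,\dots$, $\bot,\to,\land,\lor,\forall,\exists$, no function symbols; $\Phi(x_0,\dots,x_{n-1})$ is $n$-ary and a quantifier in an $n$-ary formula binds $x_n$. State declarations $C\vdash\Phi$ for $\ll$-contexts $C$ of length $n$, $n$-ary $\Phi$: $C\vdash\bot$ always; $C\vdash Rx_{k_0}\dots x_{k_{m-1}}$ iff some $j_0,\dots,j_{m-1}$ with $j_l\ge i_{k_l}$ satisfy $R:(j_0,\dots,j_{m-1})\in\Sigma^{\mathcal I}$; $C\vdash\Phi\circ\Psi$ iff $C\vdash\Phi$ and $C\vdash\Psi$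 ($\circ\in\{\to,\land,\lor\}$); $C\vdash\forall x\Psi$ iff $C\vdash\exists x\Psi$ iff $Ci\vdash\Psi$ for some $i$ with $C\ll i$. A formula is approximable (in $\Sigma^{\mathcal I}$ with $\ll$) if it has some state declaration. For a directed subset $\mathcal J\subseteq\mathcal I$, $\Sigma^{\mathcal J}$ consists of those $R:C\in\Sigma^{\mathcal I}$ with $C\in\mathcal J^n$, and the restriction of $\ll$ to $\mathcal J$ is $(\ll_n\cap\mathcal J^n)_n$. A directed $\mathcal J\subseteq\mathcal I$ is a possible restriction for $\mathcal T$ iff all formulas of $\mathcal T$ are approximable in $\Sigma^{\mathcal J}$ with the restriction of $\ll$ to $\mathcal J$. -}

module Defs where

open import Data.Nat using (ℕ; suc)
open import Data.Fin using (Fin)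
open import Data.Vec using (Vec; lookup; _∷ʳ_; map)
open import Data.Product using (Σ; ∃; _×_; _,_; proj₁)
open import Data.Unit using (⊤)
open import Data.List using (List)
open import Data.List.Relation.Unary.All using (All)

record Signature : Set₁ where
  field
    Sym   : Set
    arity : Sym → ℕ

-- Formulas over Σ.  'Formula Sg n' is the type of n-ary formulas,
-- i.e. formulas whose free variables are among x_0 … x_{n-1}.
-- A quantifier in an n-ary formula binds x_n (the last index of Fin (suc n)).
data Formula (Sg : Signature) : ℕ → Set where
  ⊥'       : ∀ {n} → Formula Sg n
  atom     : ∀ {n} (R : Signature.Sym Sg) → Vec (Fin n) (Signature.arity Sg R) → Formula Sg n
  _⇒'_     : ∀ {n} → Formula Sg n → Formula Sg n → Formula Sg n
  _∧'_     : ∀ {n} → Formula Sg n → Formula Sg n → Formula Sg n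
  _∨'_     : ∀ {n} → Formula Sg n → Formula Sg n → Formula Sg n
  all'     : ∀ {n} → Formula Sg (suc n) → Formula Sg n
  ex'      : ∀ {n} → Formula Sg (suc n) → Formula Sg n

-- The data: index set I with a relation ≤, a set Σ^I of assignments R:C
-- (as a predicate on tuples of the right arity), and a family ≪ = (≪_n)_n.
record Struct (Sg : Signature) : Set₁ where
  open Signature Sg
  field
    Idx  : Set
    _≤_  : Idx → Idx → Set
    SigI : (R : Sym) → Vec Idx (arity R) → Set
    ll   : (n : ℕ) → Vec Idx n → Set

module _ {Sg : Signature} (S : Struct Sg) where
  open Signature Sg
  open Struct S

  IsPreorderS : Set
  IsPreorderS = (∀ i → i ≤ i) × (∀ {i j k} → i ≤ j → j ≤ k → i ≤ k)

  Directed : (Idx → Set) → Set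
  Directed P = (∃ λ i → P i)
             × (∀ i j → P i → P j → ∃ λ k → P k × i ≤ k × j ≤ k)

  SigNonEmpty : Set
  SigNonEmpty = ∀ R → ∃ λ (C : Vec Idx (arity R)) → SigI R C

  IsLLRelation : Set
  IsLLRelation = ∀ n (C : Vec Idx n) (i : Idx) → ll (suc n) (C ∷ʳ i) → ll n C

  _≪_ : ∀ {n} → Vec Idx n → Idx → Set
  C ≪ i = ll _ (C ∷ʳ i)

  _⊢_ : ∀ {n} → Vec Idx n → Formula Sg n → Set
  C ⊢ ⊥'        = ⊤
  C ⊢ atom R ks = ∃ λ (js : Vec Idx (arity R)) →
                    (∀ l → lookup C (lookup ks l) ≤ lookup js l) × SigI R js
  C ⊢ (Φ ⇒' Ψ)  = (C ⊢ Φ) × (C ⊢ Ψ)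
  C ⊢ (Φ ∧' Ψ)  = (C ⊢ Φ) × (C ⊢ Ψ)
  C ⊢ (Φ ∨' Ψ)  = (C ⊢ Φ) × (C ⊢ Ψ)
  C ⊢ all' Ψ    = ∃ λ i → C ≪ i × ((C ∷ʳ i) ⊢ Ψ)
  C ⊢ ex' Ψ     = ∃ λ i → C ≪ i × ((C ∷ʳ i) ⊢ Ψ)

  Approximable : ∀ {n} → Formula Sg n → Set
  Approximable {n} Φ = ∃ λ (C : Vec Idx n) → ll n C × (C ⊢ Φ)

Restrict : {Sg : Signature} → (S : Struct Sg) → (Struct.Idx S → Set) → Struct Sg
Restrict S P = record
  { Idx  = Σ (Struct.Idx S) P
  ; _≤_  = λ a b → Struct._≤_ S (proj₁ a) (proj₁ b)
  ; SigI = λ R C → Struct.SigI S R (map proj₁ C)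
  ; ll   = λ n C → Struct.ll S n (map proj₁ C)
  }

Theory : Signature → Set
Theory Sg = List (Σ ℕ (Formula Sg))

PossibleRestriction : {Sg : Signature} (S : Struct Sg) → (Struct.Idx S → Set) → Theory Sg → Set
PossibleRestriction S P T =
  Directed S P × All (λ nΦ → Approximable (Restrict S P) (Data.Product.proj₂ nΦ)) T

-- A state declaration mentions only finitely many indices: those of its
-- context, the witnesses j of its atoms and the witnesses i of its
-- quantifiers.  Every declaration whose indices all lie in J is verbatim a
-- declaration in Σ^J with ≪ restricted to J.  So J := I₀ together with all
-- indices of one chosen declaration per formula of T works, once a common
-- upper bound u of these finitely many indices (which exists since I is
-- directed) is added to make J directed.
module Submission where

open import Defs
open import Data.Product using (Σ; ∃; _×_; proj₂)
open import Data.Unit using (⊤)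
open import Data.List using (List)
open import Data.List.Relation.Unary.All using (All)
open import Data.List.Membership.Propositional using (_∈_)

open import Data.Product using (_,_; proj₁)
open import Data.Unit using (tt)
open import Data.List using ([]; _∷_; _++_)
open import Data.List.Relation.Unary.All using ([]; _∷_)
import Data.List.Relation.Unary.All as All
open import Data.List.Relation.Unary.All.Properties using (++⁻ˡ; ++⁻ʳ)
open import Data.List.Relation.Unary.Any using (here; there)
open import Data.List.Membership.Propositional.Properties using (∈-++⁺ʳ; ∈-++⁺ˡ)
open import Data.Fin using (Fin; zero; suc)
open import Data.Vec using (Vec; toList; map; lookup; _∷ʳ_) renaming ([] to []ᵛ; _∷_ to _∷ᵛ_)
open import Data.Vec.Properties using (lookup-map; map-∷ʳ)
import Data.Vec.Relation.Unary.All as Allᵛ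
open import Data.Vec.Relation.Unary.All.Properties using (toList⁻)
open import Relation.Binary.PropositionalEquality using (_≡_; refl; sym; cong; subst; subst₂)

module _ {Sg : Signature} (S : Struct Sg) where
  open Struct S

  usedIndices : ∀ {n} {C : Vec Idx n} (Φ : Formula Sg n) → _⊢_ S C Φ → List Idx
  usedIndices ⊥'          _             = []
  usedIndices (atom R ks) (js , _)      = toList js
  usedIndices (Φ ⇒' Ψ)    (d , e)       = usedIndices Φ d ++ usedIndices Ψ e
  usedIndices (Φ ∧' Ψ)    (d , e)       = usedIndices Φ d ++ usedIndices Ψ e
  usedIndices (Φ ∨' Ψ)    (d , e)       = usedIndices Φ d ++ usedIndices Ψ e
  usedIndices (all' Ψ)    (i , _ , d)   = i ∷ usedIndices Ψ d
  usedIndices (ex' Ψ)     (i , _ , d)   = i ∷ usedIndices Ψ d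

  usedIndicesᵃ : ∀ {n} {Φ : Formula Sg n} → Approximable S Φ → List Idx
  usedIndicesᵃ {Φ = Φ} (C , _ , d) = toList C ++ usedIndices Φ d

  theoryIndices : {T : Theory Sg} → All (λ nΦ → Approximable S (proj₂ nΦ)) T → List Idx
  theoryIndices []       = []
  theoryIndices (w ∷ ws) = usedIndicesᵃ w ++ theoryIndices ws

module _ {Sg : Signature} (S : Struct Sg) (P : Struct.Idx S → Set) where
  open Struct S

  attach : ∀ {n} {C : Vec Idx n} → Allᵛ.All P C → Vec (Σ Idx P) n
  attach Allᵛ.[]       = []ᵛ
  attach (p Allᵛ.∷ ps) = (_ , p) ∷ᵛ attach ps

  map-proj₁-attach : ∀ {n} {C : Vec Idx n} (ps : Allᵛ.All P C) → map proj₁ (attach ps) ≡ C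
  map-proj₁-attach Allᵛ.[]       = refl
  map-proj₁-attach (p Allᵛ.∷ ps) = cong (_ ∷ᵛ_) (map-proj₁-attach ps)

  proj₁-lookup-attach : ∀ {n} {C : Vec Idx n} (ps : Allᵛ.All P C) (l : Fin n) →
                        proj₁ (lookup (attach ps) l) ≡ lookup C l
  proj₁-lookup-attach (p Allᵛ.∷ ps) zero    = refl
  proj₁-lookup-attach (p Allᵛ.∷ ps) (suc l) = proj₁-lookup-attach ps l

  ⊢-restrict : ∀ {n} (C′ : Vec (Σ Idx P) n) {C : Vec Idx n} → map proj₁ C′ ≡ C →
               (Φ : Formula Sg n) (d : _⊢_ S C Φ) → All P (usedIndices S Φ d) →
               _⊢_ (Restrict S P) C′ Φ
  ⊢-restrict C′ eq ⊥' _ _ = tt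
  ⊢-restrict C′ refl (atom R ks) (js , C≤js , js∈Σ) ps =
    attach js∈P ,
    (λ l → subst₂ _≤_ (lookup-map (lookup ks l) proj₁ C′)
                      (sym (proj₁-lookup-attach js∈P l)) (C≤js l)) ,
    subst (SigI R) (sym (map-proj₁-attach js∈P)) js∈Σ
    where js∈P = toList⁻ ps
  ⊢-restrict C′ eq (Φ ⇒' Ψ) (d , e) ps =
    ⊢-restrict C′ eq Φ d (++⁻ˡ _ ps) , ⊢-restrict C′ eq Ψ e (++⁻ʳ _ ps)
  ⊢-restrict C′ eq (Φ ∧' Ψ) (d , e) ps =
    ⊢-restrict C′ eq Φ d (++⁻ˡ _ ps) , ⊢-restrict C′ eq Ψ e (++⁻ʳ _ ps)
  ⊢-restrict C′ eq (Φ ∨' Ψ) (d , e) ps =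
    ⊢-restrict C′ eq Φ d (++⁻ˡ _ ps) , ⊢-restrict C′ eq Ψ e (++⁻ʳ _ ps)
  ⊢-restrict C′ refl (all' Ψ) (i , C≪i , d) (p ∷ ps) =
    (i , p) , subst (ll _) (sym extend) C≪i , ⊢-restrict (C′ ∷ʳ (i , p)) extend Ψ d ps
    where extend = map-∷ʳ proj₁ (i , p) C′
  ⊢-restrict C′ refl (ex' Ψ) (i , C≪i , d) (p ∷ ps) =
    (i , p) , subst (ll _) (sym extend) C≪i , ⊢-restrict (C′ ∷ʳ (i , p)) extend Ψ d ps
    where extend = map-∷ʳ proj₁ (i , p) C′

  approximable-restrict : ∀ {n} {Φ : Formula Sg n} (w : Approximable S Φ) →
                          All P (usedIndicesᵃ S w) → Approximable (Restrict S P) Φ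
  approximable-restrict {Φ = Φ} (C , C∈≪ , d) ps =
    attach C∈P ,
    subst (ll _) (sym (map-proj₁-attach C∈P)) C∈≪ ,
    ⊢-restrict (attach C∈P) (map-proj₁-attach C∈P) Φ d (++⁻ʳ _ ps)
    where C∈P = toList⁻ (++⁻ˡ _ ps)

  theory-restrict : {T : Theory Sg} (ws : All (λ nΦ → Approximable S (proj₂ nΦ)) T) →
                    All P (theoryIndices S ws) →
                    All (λ nΦ → Approximable (Restrict S P) (proj₂ nΦ)) T
  theory-restrict []       _  = []
  theory-restrict (w ∷ ws) ps =
    approximable-restrict w (++⁻ˡ _ ps) ∷ theory-restrict ws (++⁻ʳ _ ps)

module _ {Sg : Signature} (S : Struct Sg) where
  open Struct S

  upperBound : IsPreorderS S → Directed S (λ _ → ⊤) →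
               (L : List Idx) → ∃ λ u → All (_≤ u) L
  upperBound _ ((i , _) , _) [] = i , []
  upperBound preorder@(_ , ≤-trans) directed@(_ , bound) (x ∷ L)
    with upperBound preorder directed L
  ... | u , L≤u with bound x u tt tt
  ...   | k , _ , x≤k , u≤k = k , x≤k ∷ All.map (λ i≤u → ≤-trans i≤u u≤k) L≤u

  greatest⇒directed : ∀ {P : Idx → Set} {u : Idx} →
                      P u → (∀ i → P i → i ≤ u) → Directed S P
  greatest⇒directed {u = u} u∈P below = (u , u∈P) , λ i j i∈P j∈P → u , u∈P , below i i∈P , below j j∈P

lemma3p5 : (Sg : Signature) (S : Struct Sg)
    → IsPreorderS S
    → Directed S (λ _ → ⊤)
    → SigNonEmpty S
    → IsLLRelation S
    → (T : Theory Sg)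
    → All (λ nΦ → Approximable S (proj₂ nΦ)) T
    → (I₀ : List (Struct.Idx S))
    → ∃ λ (J : List (Struct.Idx S))
        → (∀ i → i ∈ I₀ → i ∈ J) × PossibleRestriction S (λ i → i ∈ J) T
lemma3p5 Sg S preorder@(≤-refl , _) directed _ _ T ws I₀ =
  J , (λ i i∈I₀ → there (∈-++⁺ˡ i∈I₀)) ,
  greatest⇒directed S (here refl) below-u ,
  theory-restrict S (_∈ J) ws (All.tabulate (λ i∈ws → there (∈-++⁺ʳ I₀ i∈ws)))
  where
  open Struct S using (Idx; _≤_)
  base : List Idx
  base = I₀ ++ theoryIndices S ws
  u : Idx
  u = proj₁ (upperBound S preorder directed base)
  J : List Idx
  J = u ∷ base
  below-u : ∀ i → i ∈ J → i ≤ u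
  below-u i (here refl) = ≤-refl i
  below-u i (there i∈base) = All.lookup (proj₂ (upperBound S preorder directed base)) i∈base
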